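{- Let $y_1,\dots,y_u$ be pairwise disjoint edges of $G$, each having property (P). Let $w=(\tilde w,a)\in\mathbb{N}B$ and let $w=\sum_{i=1}^q\alpha_i(v_i,1)+\sum_{i=1}^n\beta_i(e_i,1)+\lambda e_{n+1}$ with $\alpha_i,\beta_i,\lambda\in\mathbb{N}$ be a representation for which $\sum_{i=1}^u\alpha_i$ is maximal among all such representations of $w$. Then for each $k\in\{1,\dots,u\}$, writing $y_k=\{x_{j_1},x_{j_2}\}$, we have $\alpha_k=\tilde w\cdot e_{j_1}$ or $\alpha_k=\tilde w\cdot e_{j_2}$.
   Context: $G$ is a connected simple graph with $V(G)=\{x_1,\dots,x_n\}$, $E(G)=\{y_1,\dots,y_q\}\neq\emptyset$; $e_1,\dots,e_n$ the canonical basis of $\mathbb{R}^n$, $v_k=e_i+e_j$ the characteristic vector of $y_k=\{x_i,x_j\}$, $e_{n+1}=(0,\dots,0,1)\in\mathbb{R}^{n+1}$, $B=\{(e_1,1),\dots,(e_n,1),(v_1,1),\dots,(v_q,1),e_{n+1}\}$, $\mathbb{N}B$ the set of nonnegative integer combinations of $B$. An edge $\{x,x'\}$ has property (P) if $\{z,z'\}\in E(G)$ whenever $\{x,z\},\{x',z'\}\in E(G)$. -}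

module Defs where

open import Data.Nat using (ℕ; zero; suc; _+_; _*_; _≤_)
open import Data.Fin using (Fin; zero; suc; _≟_; inject≤)
open import Data.Product using (Σ; ∃; _×_; _,_)
open import Data.Sum using (_⊎_)
open import Relation.Nullary using (¬_; yes; no)
open import Relation.Binary.PropositionalEquality using (_≡_; _≢_)

Vecℕ : ℕ → Set
Vecℕ m = Fin m → ℕ

sumFin : (m : ℕ) → (Fin m → ℕ) → ℕ
sumFin zero    f = 0
sumFin (suc m) f = f zero + sumFin m (λ i → f (suc i))

basis : {m : ℕ} → Fin m → Vecℕ m
basis i j with i ≟ j
... | yes _ = 1
... | no  _ = 0

_⊕_ : {m : ℕ} → Vecℕ m → Vecℕ m → Vecℕ m
(x ⊕ y) j = x j + y j

_⊙_ : {m : ℕ} → ℕ → Vecℕ m → Vecℕ m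
(c ⊙ x) j = c * x j

zeroV : {m : ℕ} → Vecℕ m
zeroV _ = 0

lincomb : {m : ℕ} (k : ℕ) → (Fin k → ℕ) → (Fin k → Vecℕ m) → Vecℕ m
lincomb zero    c x = zeroV
lincomb (suc k) c x = (c zero ⊙ x zero) ⊕ lincomb k (λ i → c (suc i)) (λ i → x (suc i))

_·_ : {m : ℕ} → Vecℕ m → Vecℕ m → ℕ
_·_ {m} x y = sumFin m (λ j → x j * y j)

-- (x , a) ∈ ℕ^{n+1}: append a last coordinate a to x ∈ ℕ^n
appendLast : {n : ℕ} → Vecℕ n → ℕ → Vecℕ (suc n)
appendLast {zero}  x a zero    = a
appendLast {suc n} x a zero    = x zero
appendLast {suc n} x a (suc j) = appendLast (λ i → x (suc i)) a j

eLast : {n : ℕ} → Vecℕ (suc n)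
eLast = appendLast zeroV 1

_≗V_ : {m : ℕ} → Vecℕ m → Vecℕ m → Set
x ≗V y = ∀ j → x j ≡ y j

-- A simple graph with vertex set {x_1,…,x_n} = Fin n and edge list
-- y_1,…,y_q given by their two end points (Fin q).
record SimpleGraph (n q : ℕ) : Set where
  field
    end₁ end₂ : Fin q → Fin n
    noLoop    : ∀ k → end₁ k ≢ end₂ k
    noMulti   : ∀ k l →
                (end₁ k ≡ end₁ l × end₂ k ≡ end₂ l) ⊎ (end₁ k ≡ end₂ l × end₂ k ≡ end₁ l) →
                k ≡ l

module _ {n q : ℕ} (G : SimpleGraph n q) where
  open SimpleGraph G

  Adj : Fin n → Fin n → Set
  Adj x z = ∃ λ k → (end₁ k ≡ x × end₂ k ≡ z) ⊎ (end₁ k ≡ z × end₂ k ≡ x)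

  data Reach (x : Fin n) : Fin n → Set where
    here : Reach x x
    step : ∀ {y z} → Reach x y → Adj y z → Reach x z

  Connected : Set
  Connected = ∀ x z → Reach x z

  charVec : Fin q → Vecℕ n
  charVec k = basis (end₁ k) ⊕ basis (end₂ k)

  PropertyP : Fin q → Set
  PropertyP k = ∀ z z' → Adj (end₁ k) z → Adj (end₂ k) z' → Adj z z'

  DisjointEdges : Fin q → Fin q → Set
  DisjointEdges k l = end₁ k ≢ end₁ l × end₁ k ≢ end₂ l × end₂ k ≢ end₁ l × end₂ k ≢ end₂ l

  IsRep : Vecℕ (suc n) → (Fin q → ℕ) → (Fin n → ℕ) → ℕ → Set
  IsRep w α β λ′ =
    w ≗V (lincomb q α (λ i → appendLast (charVec i) 1)
          ⊕ (lincomb n β (λ i → appendLast (basis i) 1)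
          ⊕ (λ′ ⊙ eLast)))

-- If αₖ differed from both w̃ⱼ₁ and w̃ⱼ₂, each end j of yₖ would be covered by a second generator
-- with positive coefficient: (eⱼ , 1), or (vₗ , 1) with l ≠ k, and such an l is none of y₁ … yᵤ
-- because these edges are pairwise disjoint. The two covering generators sum to (vₖ , 1) plus one of
-- e_{n+1}, (e_z , 1) or (v_p , 1), the last an edge by property (P). Trading them raises αₖ and
-- lowers no other αᵢ with i ≤ u, against maximality.

module Submission where

open import Defs
open import Data.Nat using (ℕ; zero; suc; _+_; _*_; _∸_; _≤_; _<_; _≥_; z≤n)
import Data.Nat as ℕ
open import Data.Nat.Properties
  using (+-identityʳ; *-identityʳ; *-identityˡ; *-zeroʳ; *-distribʳ-+; +-comm; +-mono-≤;
         +-mono-<-≤; +-mono-≤-<; m≤m+n; m<m+n; ≤-trans; ≤-<-trans; ≤-reflexive; ≤⇒≯;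
         n≢0⇒n>0; m∸n+n≡m; +-commutativeSemigroup)
open import Algebra.Properties.CommutativeSemigroup +-commutativeSemigroup
  using (interchange; xy∙z≈xz∙y; xy∙z≈x∙zy)
open import Data.Fin using (Fin; zero; suc; _≟_; inject₁; inject≤; fromℕ)
open import Data.Fin.Properties using (suc-injective; ¬∀⟶∃¬)
open import Data.Product using (∃; _×_; _,_; proj₁)
open import Data.Sum using (_⊎_; inj₁; inj₂; [_,_]′; map)
open import Data.Empty using (⊥; ⊥-elim)
open import Function using (_∘_; id; case_of_)
open import Relation.Nullary using (¬_; yes; no)
open import Relation.Nullary.Decidable using (_⊎-dec_)
open import Relation.Binary.PropositionalEquality
  using (_≡_; _≢_; refl; sym; trans; cong; cong₂; subst; module ≡-Reasoning)
open import Data.Nat.Tactic.RingSolver using (solve-∀)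

basis-diag : ∀ {m} (i : Fin m) → basis i i ≡ 1
basis-diag i with i ≟ i
... | yes _  = refl
... | no i≢i = ⊥-elim (i≢i refl)

basis-offdiag : ∀ {m} {i j : Fin m} → i ≢ j → basis i j ≡ 0
basis-offdiag {i = i} {j} i≢j with i ≟ j
... | yes i≡j = ⊥-elim (i≢j i≡j)
... | no _    = refl

basis-nonzero⇒≡ : ∀ {m} {i j : Fin m} → basis i j ≢ 0 → i ≡ j
basis-nonzero⇒≡ {i = i} {j} b≢0 with i ≟ j
... | yes i≡j = i≡j
... | no _    = ⊥-elim (b≢0 refl)

sumFin-cong : ∀ m {f g : Vecℕ m} → f ≗V g → sumFin m f ≡ sumFin m g
sumFin-cong zero    f≗g = refl
sumFin-cong (suc m) f≗g = cong₂ _+_ (f≗g zero) (sumFin-cong m (f≗g ∘ suc))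

sumFin-⊕ : ∀ m (f g : Vecℕ m) → sumFin m (f ⊕ g) ≡ sumFin m f + sumFin m g
sumFin-⊕ zero    f g = refl
sumFin-⊕ (suc m) f g =
  trans (cong (f zero + g zero +_) (sumFin-⊕ m (f ∘ suc) (g ∘ suc)))
        (interchange (f zero) (g zero) _ _)

sumFin-zeroV : ∀ m → sumFin m zeroV ≡ 0
sumFin-zeroV zero    = refl
sumFin-zeroV (suc m) = sumFin-zeroV m

sumFin-single : ∀ m (f : Vecℕ m) k → (∀ i → i ≢ k → f i ≡ 0) → sumFin m f ≡ f k
sumFin-single (suc m) f zero    f≡0 =
  trans (cong (f zero +_) (trans (sumFin-cong m (λ i → f≡0 (suc i) λ ())) (sumFin-zeroV m)))
        (+-identityʳ (f zero))
sumFin-single (suc m) f (suc k) f≡0 =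
  cong₂ _+_ (f≡0 zero λ ())
            (sumFin-single m (f ∘ suc) k λ i i≢k → f≡0 (suc i) (i≢k ∘ suc-injective))

sumFin-basis : ∀ m (k : Fin m) → sumFin m (basis k) ≡ 1
sumFin-basis m k =
  trans (sumFin-single m (basis k) k λ i i≢k → basis-offdiag (i≢k ∘ sym)) (basis-diag k)

sumFin-nonzero-elsewhere : ∀ m (f : Vecℕ m) k → sumFin m f ≢ f k → ∃ λ l → l ≢ k × f l ≢ 0
sumFin-nonzero-elsewhere m f k sum≢fk
  with ¬∀⟶∃¬ m (λ l → l ≡ k ⊎ f l ≡ 0) (λ l → (l ≟ k) ⊎-dec (f l ℕ.≟ 0)) ¬vanishes-elsewhere
  where
  ¬vanishes-elsewhere : ¬ (∀ l → l ≡ k ⊎ f l ≡ 0)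
  ¬vanishes-elsewhere h = sum≢fk (sumFin-single m f k λ l l≢k → [ ⊥-elim ∘ l≢k , id ]′ (h l))
... | l , ¬[l≡k⊎fl≡0] = l , ¬[l≡k⊎fl≡0] ∘ inj₁ , ¬[l≡k⊎fl≡0] ∘ inj₂

sumFin-mono-≤ : ∀ m {f g : Vecℕ m} → (∀ i → f i ≤ g i) → sumFin m f ≤ sumFin m g
sumFin-mono-≤ zero    f≤g = z≤n
sumFin-mono-≤ (suc m) f≤g = +-mono-≤ (f≤g zero) (sumFin-mono-≤ m (f≤g ∘ suc))

sumFin-mono-< : ∀ m {f g : Vecℕ m} k → (∀ i → f i ≤ g i) → f k < g k → sumFin m f < sumFin m g
sumFin-mono-< (suc m) zero    f≤g fk<gk = +-mono-<-≤ fk<gk (sumFin-mono-≤ m (f≤g ∘ suc))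
sumFin-mono-< (suc m) (suc k) f≤g fk<gk =
  +-mono-≤-< (f≤g zero) (sumFin-mono-< m k (f≤g ∘ suc) fk<gk)

lincomb-apply : ∀ {m} k (c : Vecℕ k) (x : Fin k → Vecℕ m) j →
                lincomb k c x j ≡ sumFin k (λ i → c i * x i j)
lincomb-apply zero    c x j = refl
lincomb-apply (suc k) c x j =
  cong (c zero * x zero j +_) (lincomb-apply k (c ∘ suc) (x ∘ suc) j)

lincomb-cong : ∀ {m} k {c d : Vecℕ k} (x : Fin k → Vecℕ m) →
               c ≗V d → lincomb k c x ≗V lincomb k d x
lincomb-cong zero    x c≗d j = refl
lincomb-cong (suc k) x c≗d j =
  cong₂ _+_ (cong (_* x zero j) (c≗d zero)) (lincomb-cong k (x ∘ suc) (c≗d ∘ suc) j)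

lincomb-⊕ : ∀ {m} k (c d : Vecℕ k) (x : Fin k → Vecℕ m) →
            lincomb k (c ⊕ d) x ≗V (lincomb k c x ⊕ lincomb k d x)
lincomb-⊕ zero    c d x j = refl
lincomb-⊕ (suc k) c d x j =
  trans (cong₂ _+_ (*-distribʳ-+ (x zero j) (c zero) (d zero))
                   (lincomb-⊕ k (c ∘ suc) (d ∘ suc) (x ∘ suc) j))
        (interchange (c zero * x zero j) (d zero * x zero j) _ _)

lincomb-zeroV : ∀ {m} k (x : Fin k → Vecℕ m) → lincomb k zeroV x ≗V zeroV
lincomb-zeroV zero    x j = refl
lincomb-zeroV (suc k) x j = lincomb-zeroV k (x ∘ suc) j

lincomb-basis : ∀ {m} k (l : Fin k) (x : Fin k → Vecℕ m) → lincomb k (basis l) x ≗V x l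
lincomb-basis k l x j = begin
  lincomb k (basis l) x j              ≡⟨ lincomb-apply k (basis l) x j ⟩
  sumFin k (λ i → basis l i * x i j)   ≡⟨ sumFin-single k _ l (λ i i≢l →
                                            cong (_* x i j) (basis-offdiag (i≢l ∘ sym))) ⟩
  basis l l * x l j                    ≡⟨ cong (_* x l j) (basis-diag l) ⟩
  1 * x l j                            ≡⟨ *-identityˡ (x l j) ⟩
  x l j                                ∎
  where open ≡-Reasoning

lincomb-basisVectors : ∀ m (c : Vecℕ m) → lincomb m c basis ≗V c
lincomb-basisVectors m c j = begin
  lincomb m c basis j                  ≡⟨ lincomb-apply m c basis j ⟩
  sumFin m (λ i → c i * basis i j)     ≡⟨ sumFin-single m _ j (λ i i≢j →
                                            trans (cong (c i *_) (basis-offdiag i≢j)) (*-zeroʳ (c i))) ⟩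
  c j * basis j j                      ≡⟨ cong (c j *_) (basis-diag j) ⟩
  c j * 1                              ≡⟨ *-identityʳ (c j) ⟩
  c j                                  ∎
  where open ≡-Reasoning

·-basis : ∀ {m} (x : Vecℕ m) j → x · basis j ≡ x j
·-basis {m} x j = begin
  sumFin m (λ i → x i * basis j i)     ≡⟨ sumFin-single m _ j (λ i i≢j →
                                            trans (cong (x i *_) (basis-offdiag (i≢j ∘ sym))) (*-zeroʳ (x i))) ⟩
  x j * basis j j                      ≡⟨ cong (x j *_) (basis-diag j) ⟩
  x j * 1                              ≡⟨ *-identityʳ (x j) ⟩
  x j                                  ∎
  where open ≡-Reasoning

appendLast-cong : ∀ {n} {x y : Vecℕ n} {a b} →
                  x ≗V y → a ≡ b → appendLast x a ≗V appendLast y b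
appendLast-cong {zero}  x≗y a≡b zero    = a≡b
appendLast-cong {suc n} x≗y a≡b zero    = x≗y zero
appendLast-cong {suc n} x≗y a≡b (suc j) = appendLast-cong (x≗y ∘ suc) a≡b j

appendLast-⊕ : ∀ {n} (x y : Vecℕ n) a b →
               (appendLast x a ⊕ appendLast y b) ≗V appendLast (x ⊕ y) (a + b)
appendLast-⊕ {zero}  x y a b zero    = refl
appendLast-⊕ {suc n} x y a b zero    = refl
appendLast-⊕ {suc n} x y a b (suc j) = appendLast-⊕ (x ∘ suc) (y ∘ suc) a b j

appendLast-⊙ : ∀ {n} c (x : Vecℕ n) a → (c ⊙ appendLast x a) ≗V appendLast (c ⊙ x) (c * a)
appendLast-⊙ {zero}  c x a zero    = refl
appendLast-⊙ {suc n} c x a zero    = refl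
appendLast-⊙ {suc n} c x a (suc j) = appendLast-⊙ c (x ∘ suc) a j

appendLast-zeroV : ∀ {n} → appendLast {n} zeroV 0 ≗V zeroV
appendLast-zeroV {zero}  zero    = refl
appendLast-zeroV {suc n} zero    = refl
appendLast-zeroV {suc n} (suc j) = appendLast-zeroV j

appendLast-inject₁ : ∀ {n} (x : Vecℕ n) a j → appendLast x a (inject₁ j) ≡ x j
appendLast-inject₁ {suc n} x a zero    = refl
appendLast-inject₁ {suc n} x a (suc j) = appendLast-inject₁ (x ∘ suc) a j

appendLast-fromℕ : ∀ {n} (x : Vecℕ n) a → appendLast x a (fromℕ n) ≡ a
appendLast-fromℕ {zero}  x a = refl
appendLast-fromℕ {suc n} x a = appendLast-fromℕ (x ∘ suc) a

appendLast-injective : ∀ {n} {x y : Vecℕ n} {a b} →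
                       appendLast x a ≗V appendLast y b → x ≗V y × a ≡ b
appendLast-injective {n} {x} {y} {a} {b} eq =
  (λ j → trans (sym (appendLast-inject₁ x a j)) (trans (eq (inject₁ j)) (appendLast-inject₁ y b j))) ,
  trans (sym (appendLast-fromℕ x a)) (trans (eq (fromℕ n)) (appendLast-fromℕ y b))

lincomb-appendLast : ∀ {n} k (c : Vecℕ k) (x : Fin k → Vecℕ n) →
  lincomb k c (λ i → appendLast (x i) 1) ≗V appendLast (lincomb k c x) (sumFin k c)
lincomb-appendLast zero    c x j = sym (appendLast-zeroV j)
lincomb-appendLast (suc k) c x j = begin
  c zero * appendLast (x zero) 1 j + lincomb k (c ∘ suc) (λ i → appendLast (x (suc i)) 1) j
    ≡⟨ cong₂ _+_ (appendLast-⊙ (c zero) (x zero) 1 j) (lincomb-appendLast k (c ∘ suc) (x ∘ suc) j) ⟩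
  appendLast (c zero ⊙ x zero) (c zero * 1) j
    + appendLast (lincomb k (c ∘ suc) (x ∘ suc)) (sumFin k (c ∘ suc)) j
    ≡⟨ appendLast-⊕ _ _ _ _ j ⟩
  appendLast (lincomb (suc k) c x) (c zero * 1 + sumFin k (c ∘ suc)) j
    ≡⟨ appendLast-cong (λ _ → refl) (cong (_+ sumFin k (c ∘ suc)) (*-identityʳ (c zero))) j ⟩
  appendLast (lincomb (suc k) c x) (sumFin (suc k) c) j
    ∎
  where open ≡-Reasoning

decrement : ∀ {m} → Vecℕ m → Fin m → Vecℕ m
decrement c l i = c i ∸ basis l i

decrement-⊕-basis : ∀ {m} (c : Vecℕ m) {l} → c l ≢ 0 → c ≗V (decrement c l ⊕ basis l)
decrement-⊕-basis c {l} cl≢0 i with l ≟ i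
... | yes refl = sym (m∸n+n≡m (n≢0⇒n>0 cl≢0))
... | no  _    = sym (+-identityʳ (c i))

decrement₂-⊕-basis : ∀ {m} (c : Vecℕ m) {l l′} → c l ≢ 0 → c l′ ≢ 0 → l ≢ l′ →
                     c ≗V (decrement (decrement c l) l′ ⊕ (basis l ⊕ basis l′))
decrement₂-⊕-basis c {l} {l′} cl≢0 cl′≢0 l≢l′ i = begin
  c i                                                     ≡⟨ decrement-⊕-basis c cl≢0 i ⟩
  decrement c l i + basis l i                             ≡⟨ cong (_+ basis l i)
                                                               (decrement-⊕-basis (decrement c l) cl′-l≢0 i) ⟩
  decrement (decrement c l) l′ i + basis l′ i + basis l i ≡⟨ xy∙z≈x∙zy _ (basis l′ i) (basis l i) ⟩
  decrement (decrement c l) l′ i + (basis l i + basis l′ i) ∎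
  where
  open ≡-Reasoning
  cl′-l≢0 : decrement c l l′ ≢ 0
  cl′-l≢0 = subst (_≢ 0) (sym (cong (c l′ ∸_) (basis-offdiag l≢l′))) cl′≢0

module _ {n q : ℕ} (G : SimpleGraph n q) where
  open SimpleGraph G

  Incident : Fin q → Fin n → Set
  Incident l x = end₁ l ≡ x ⊎ end₂ l ≡ x

  Decomposes : Vecℕ n → ℕ → Vecℕ q → Vecℕ n → ℕ → Set
  Decomposes w̃ a α β λ′ = w̃ ≗V (lincomb q α (charVec G) ⊕ β) × a ≡ sumFin q α + (sumFin n β + λ′)

  combination-appendLast : ∀ α β λ′ →
    (lincomb q α (λ i → appendLast (charVec G i) 1)
       ⊕ (lincomb n β (λ i → appendLast (basis i) 1) ⊕ (λ′ ⊙ eLast)))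
      ≗V appendLast (lincomb q α (charVec G) ⊕ β) (sumFin q α + (sumFin n β + λ′))
  combination-appendLast α β λ′ j = begin
    Xα j + (Yβ j + λ′ * eLast j)
      ≡⟨ cong₂ _+_ (lincomb-appendLast q α (charVec G) j)
                   (cong₂ _+_ (lincomb-appendLast n β basis j) (appendLast-⊙ λ′ zeroV 1 j)) ⟩
    appendLast vα Σα j + (appendLast vβ Σβ j + appendLast (λ′ ⊙ zeroV) (λ′ * 1) j)
      ≡⟨ cong (appendLast vα Σα j +_) (appendLast-⊕ vβ (λ′ ⊙ zeroV) Σβ (λ′ * 1) j) ⟩
    appendLast vα Σα j + appendLast (vβ ⊕ (λ′ ⊙ zeroV)) (Σβ + λ′ * 1) j
      ≡⟨ appendLast-⊕ vα (vβ ⊕ (λ′ ⊙ zeroV)) Σα (Σβ + λ′ * 1) j ⟩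
    appendLast (vα ⊕ (vβ ⊕ (λ′ ⊙ zeroV))) (Σα + (Σβ + λ′ * 1)) j
      ≡⟨ appendLast-cong (λ i → cong (vα i +_) (vβ+0≡β i)) (cong (λ t → Σα + (Σβ + t)) (*-identityʳ λ′)) j ⟩
    appendLast (vα ⊕ β) (Σα + (Σβ + λ′)) j
      ∎
    where
    open ≡-Reasoning
    Xα vα : Vecℕ _
    Xα = lincomb q α (λ i → appendLast (charVec G i) 1)
    vα = lincomb q α (charVec G)
    Yβ vβ : Vecℕ _
    Yβ = lincomb n β (λ i → appendLast (basis i) 1)
    vβ = lincomb n β basis
    Σα Σβ : ℕ
    Σα = sumFin q α
    Σβ = sumFin n β
    vβ+0≡β : (vβ ⊕ (λ′ ⊙ zeroV)) ≗V β
    vβ+0≡β i = trans (cong₂ _+_ (lincomb-basisVectors n β i) (*-zeroʳ λ′)) (+-identityʳ (β i))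

  isRep⇒decomposes : ∀ {w̃ a α β λ′} → IsRep G (appendLast w̃ a) α β λ′ → Decomposes w̃ a α β λ′
  isRep⇒decomposes {α = α} {β} {λ′} rep =
    appendLast-injective λ j → trans (rep j) (combination-appendLast α β λ′ j)

  decomposes⇒isRep : ∀ {w̃ a α β λ′} → Decomposes w̃ a α β λ′ → IsRep G (appendLast w̃ a) α β λ′
  decomposes⇒isRep {α = α} {β} {λ′} (w̃≗ , a≡) j =
    trans (appendLast-cong w̃≗ a≡ j) (sym (combination-appendLast α β λ′ j))

  exchange : ∀ {w̃ a α β λ′} α₀ δα β₀ δβ δα′ δβ′ dλ →
    α ≗V (α₀ ⊕ δα) → β ≗V (β₀ ⊕ δβ) →
    (lincomb q δα (charVec G) ⊕ δβ) ≗V (lincomb q δα′ (charVec G) ⊕ δβ′) →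
    sumFin q δα + sumFin n δβ ≡ sumFin q δα′ + sumFin n δβ′ + dλ →
    Decomposes w̃ a α β λ′ → Decomposes w̃ a (α₀ ⊕ δα′) (β₀ ⊕ δβ′) (dλ + λ′)
  exchange {w̃} {a} {α} {β} {λ′} α₀ δα β₀ δβ δα′ δβ′ dλ α≗ β≗ δ-vectors δ-sizes (w̃≗ , a≡) =
    vectors , sizes
    where
    open ≡-Reasoning
    L : Vecℕ q → Vecℕ n
    L c = lincomb q c (charVec G)

    vectors : w̃ ≗V (L (α₀ ⊕ δα′) ⊕ (β₀ ⊕ δβ′))
    vectors j = begin
      w̃ j
        ≡⟨ w̃≗ j ⟩
      L α j + β j
        ≡⟨ cong₂ _+_ (trans (lincomb-cong q _ α≗ j) (lincomb-⊕ q α₀ δα _ j)) (β≗ j) ⟩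
      (L α₀ j + L δα j) + (β₀ j + δβ j)
        ≡⟨ interchange (L α₀ j) (L δα j) (β₀ j) (δβ j) ⟩
      (L α₀ j + β₀ j) + (L δα j + δβ j)
        ≡⟨ cong (L α₀ j + β₀ j +_) (δ-vectors j) ⟩
      (L α₀ j + β₀ j) + (L δα′ j + δβ′ j)
        ≡⟨ interchange (L α₀ j) (β₀ j) (L δα′ j) (δβ′ j) ⟩
      (L α₀ j + L δα′ j) + (β₀ j + δβ′ j)
        ≡⟨ cong (_+ (β₀ j + δβ′ j)) (sym (lincomb-⊕ q α₀ δα′ _ j)) ⟩
      L (α₀ ⊕ δα′) j + (β₀ j + δβ′ j)
        ∎

    regroup : ∀ A₀ A B₀ B l → (A₀ + A) + ((B₀ + B) + l) ≡ (A₀ + B₀ + l) + (A + B)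
    regroup = solve-∀
    regroup′ : ∀ A₀ A B₀ B l d → (A₀ + B₀ + l) + (A + B + d) ≡ (A₀ + A) + ((B₀ + B) + (d + l))
    regroup′ = solve-∀

    sizes : a ≡ sumFin q (α₀ ⊕ δα′) + (sumFin n (β₀ ⊕ δβ′) + (dλ + λ′))
    sizes = begin
      a
        ≡⟨ a≡ ⟩
      sumFin q α + (sumFin n β + λ′)
        ≡⟨ cong₂ (λ s t → s + (t + λ′)) (trans (sumFin-cong q α≗) (sumFin-⊕ q α₀ δα))
                                         (trans (sumFin-cong n β≗) (sumFin-⊕ n β₀ δβ)) ⟩
      (sumFin q α₀ + sumFin q δα) + ((sumFin n β₀ + sumFin n δβ) + λ′)
        ≡⟨ regroup (sumFin q α₀) (sumFin q δα) (sumFin n β₀) (sumFin n δβ) λ′ ⟩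
      (sumFin q α₀ + sumFin n β₀ + λ′) + (sumFin q δα + sumFin n δβ)
        ≡⟨ cong (sumFin q α₀ + sumFin n β₀ + λ′ +_) δ-sizes ⟩
      (sumFin q α₀ + sumFin n β₀ + λ′) + (sumFin q δα′ + sumFin n δβ′ + dλ)
        ≡⟨ regroup′ (sumFin q α₀) (sumFin q δα′) (sumFin n β₀) (sumFin n δβ′) λ′ dλ ⟩
      (sumFin q α₀ + sumFin q δα′) + ((sumFin n β₀ + sumFin n δβ′) + (dλ + λ′))
        ≡⟨ sym (cong₂ (λ s t → s + (t + (dλ + λ′))) (sumFin-⊕ q α₀ δα′) (sumFin-⊕ n β₀ δβ′)) ⟩
      sumFin q (α₀ ⊕ δα′) + (sumFin n (β₀ ⊕ δβ′) + (dλ + λ′))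
        ∎

  charVec-incident : ∀ {l x} → Incident l x → charVec G l x ≡ 1
  charVec-incident {l} (inj₁ refl) =
    cong₂ _+_ (basis-diag (end₁ l)) (basis-offdiag (noLoop l ∘ sym))
  charVec-incident {l} (inj₂ refl) =
    cong₂ _+_ (basis-offdiag (noLoop l)) (basis-diag (end₂ l))

  charVec-nonzero⇒incident : ∀ {l x} → charVec G l x ≢ 0 → Incident l x
  charVec-nonzero⇒incident {l} {x} v≢0 = case end₁ l ≟ x of λ where
    (yes e₁≡x) → inj₁ e₁≡x
    (no  e₁≢x) → inj₂ (basis-nonzero⇒≡ λ b≡0 → v≢0 (cong₂ _+_ (basis-offdiag e₁≢x) b≡0))

  incident⇒otherEnd : ∀ {l x} → Incident l x →
                      ∃ λ z → charVec G l ≗V (basis x ⊕ basis z) × Adj G x z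
  incident⇒otherEnd {l} (inj₁ refl) =
    end₂ l , (λ _ → refl) , l , inj₁ (refl , refl)
  incident⇒otherEnd {l} (inj₂ refl) =
    end₁ l , (λ j → +-comm (basis (end₁ l) j) _) , l , inj₂ (refl , refl)

  adj⇒edge : ∀ {x z} → Adj G x z → ∃ λ p → charVec G p ≗V (basis x ⊕ basis z)
  adj⇒edge (p , inj₁ (refl , refl)) = p , λ _ → refl
  adj⇒edge (p , inj₂ (refl , refl)) = p , λ j → +-comm (basis (end₁ p) j) _

  incident-to-both-ends : ∀ {l k} → Incident l (end₁ k) → Incident l (end₂ k) → l ≡ k
  incident-to-both-ends {l} {k} (inj₁ e₁) (inj₁ e₂) = ⊥-elim (noLoop k (trans (sym e₁) e₂))
  incident-to-both-ends {l} {k} (inj₁ e₁) (inj₂ e₂) = noMulti l k (inj₁ (e₁ , e₂))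
  incident-to-both-ends {l} {k} (inj₂ e₁) (inj₁ e₂) = noMulti l k (inj₂ (e₂ , e₁))
  incident-to-both-ends {l} {k} (inj₂ e₁) (inj₂ e₂) = ⊥-elim (noLoop k (trans (sym e₁) e₂))

  disjoint⇒¬commonVertex : ∀ {l k x} → DisjointEdges G l k → Incident l x → Incident k x → ⊥
  disjoint⇒¬commonVertex (d₁ , d₂ , d₃ , d₄) (inj₁ e) (inj₁ e′) = d₁ (trans e (sym e′))
  disjoint⇒¬commonVertex (d₁ , d₂ , d₃ , d₄) (inj₁ e) (inj₂ e′) = d₂ (trans e (sym e′))
  disjoint⇒¬commonVertex (d₁ , d₂ , d₃ , d₄) (inj₂ e) (inj₁ e′) = d₃ (trans e (sym e′))
  disjoint⇒¬commonVertex (d₁ , d₂ , d₃ , d₄) (inj₂ e) (inj₂ e′) = d₄ (trans e (sym e′))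

module MaximalRepresentation
  {n q u : ℕ} (G : SimpleGraph n q) (u≤q : u ≤ q)
  (disjoint : ∀ (i j : Fin u) → i ≢ j → DisjointEdges G (inject≤ i u≤q) (inject≤ j u≤q))
  (w̃ : Vecℕ n) (a : ℕ) (α : Vecℕ q) (β : Vecℕ n) (λ′ : ℕ)
  (rep : IsRep G (appendLast w̃ a) α β λ′)
  (maximal : ∀ α′ β′ λ″ → IsRep G (appendLast w̃ a) α′ β′ λ″ →
             sumFin u (λ i → α′ (inject≤ i u≤q)) ≤ sumFin u (λ i → α (inject≤ i u≤q)))
  (k : Fin u) (propertyP : PropertyP G (inject≤ k u≤q))
  where

  open SimpleGraph G

  decomposition : Decomposes G w̃ a α β λ′
  decomposition = isRep⇒decomposes G {λ′ = λ′} rep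

  ι : Fin u → Fin q
  ι i = inject≤ i u≤q

  K : Fin q
  K = ι k

  j₁ j₂ : Fin n
  j₁ = end₁ K
  j₂ = end₂ K

  K∋j₁ : Incident G K j₁
  K∋j₁ = inj₁ refl

  K∋j₂ : Incident G K j₂
  K∋j₂ = inj₂ refl

  ι-avoids : ∀ {l x} → l ≢ K → Incident G l x → Incident G K x → ∀ i → ι i ≢ l
  ι-avoids l≢K l∋x K∋x i ιi≡l with i ≟ k
  ... | yes refl = l≢K (sym ιi≡l)
  ... | no  i≢k  =
    disjoint⇒¬commonVertex G (subst (λ e → DisjointEdges G e K) ιi≡l (disjoint i k i≢k)) l∋x K∋x

  no-improvement : ∀ α₀ δα β₀ δβ δα′ δβ′ dλ →
    α ≗V (α₀ ⊕ δα) → β ≗V (β₀ ⊕ δβ) →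
    (lincomb q δα (charVec G) ⊕ δβ) ≗V (lincomb q δα′ (charVec G) ⊕ δβ′) →
    sumFin q δα + sumFin n δβ ≡ sumFin q δα′ + sumFin n δβ′ + dλ →
    (∀ i → δα (ι i) ≡ 0) → 0 < δα′ K → ⊥
  no-improvement α₀ δα β₀ δβ δα′ δβ′ dλ α≗ β≗ δ-vectors δ-sizes δα-vanishes δα′K>0 =
    ≤⇒≯ (maximal (α₀ ⊕ δα′) (β₀ ⊕ δβ′) (dλ + λ′) (decomposes⇒isRep G exchanged))
        (sumFin-mono-< u k (λ i → ≤-trans (≤-reflexive (α≡α₀ i)) (m≤m+n _ _))
                           (≤-<-trans (≤-reflexive (α≡α₀ k)) (m<m+n _ δα′K>0)))
    where
    exchanged : Decomposes G w̃ a (α₀ ⊕ δα′) (β₀ ⊕ δβ′) (dλ + λ′)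
    exchanged = exchange G α₀ δα β₀ δβ δα′ δβ′ dλ α≗ β≗ δ-vectors δ-sizes decomposition
    α≡α₀ : ∀ i → α (ι i) ≡ α₀ (ι i)
    α≡α₀ i = trans (α≗ (ι i)) (trans (cong (α₀ (ι i) +_) (δα-vanishes i)) (+-identityʳ (α₀ (ι i))))

  data Cover (x : Fin n) : Set where
    vertexCover : β x ≢ 0 → Cover x
    edgeCover   : ∀ l → l ≢ K → α l ≢ 0 → Incident G l x → Cover x

  other-edge-at : ∀ {x} → Incident G K x → β x ≡ 0 → α K ≢ w̃ x →
                  ∃ λ l → l ≢ K × α l * charVec G l x ≢ 0
  other-edge-at {x} K∋x βx≡0 αK≢w̃x =
    sumFin-nonzero-elsewhere q _ K λ sum≡αK*vK → αK≢w̃x (sym (begin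
      w̃ x                                        ≡⟨ proj₁ decomposition x ⟩
      lincomb q α (charVec G) x + β x             ≡⟨ cong₂ _+_ (lincomb-apply q α (charVec G) x) βx≡0 ⟩
      sumFin q (λ l → α l * charVec G l x) + 0    ≡⟨ +-identityʳ _ ⟩
      sumFin q (λ l → α l * charVec G l x)        ≡⟨ sum≡αK*vK ⟩
      α K * charVec G K x                         ≡⟨ cong (α K *_) (charVec-incident G K∋x) ⟩
      α K * 1                                     ≡⟨ *-identityʳ (α K) ⟩
      α K                                         ∎))
    where open ≡-Reasoning

  cover : ∀ {x} → Incident G K x → α K ≢ w̃ x → Cover x
  cover {x} K∋x αK≢w̃x with β x ℕ.≟ 0
  ... | no  βx≢0 = vertexCover βx≢0
  ... | yes βx≡0 with other-edge-at K∋x βx≡0 αK≢w̃x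
  ... | l , l≢K , αl*vl≢0 =
    edgeCover l l≢K
      (λ αl≡0 → αl*vl≢0 (cong (_* charVec G l x) αl≡0))
      (charVec-nonzero⇒incident G λ vl≡0 → αl*vl≢0 (trans (cong (α l *_) vl≡0) (*-zeroʳ (α l))))

  vertex-vertex : β j₁ ≢ 0 → β j₂ ≢ 0 → ⊥
  vertex-vertex βj₁≢0 βj₂≢0 =
    no-improvement α zeroV (decrement (decrement β j₁) j₂) (basis j₁ ⊕ basis j₂) (basis K) zeroV 1
      (λ i → sym (+-identityʳ (α i))) (decrement₂-⊕-basis β βj₁≢0 βj₂≢0 (noLoop K))
      vectors sizes (λ _ → refl) (≤-reflexive (sym (basis-diag K)))
    where
    open ≡-Reasoning
    vectors : (lincomb q zeroV (charVec G) ⊕ (basis j₁ ⊕ basis j₂))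
                ≗V (lincomb q (basis K) (charVec G) ⊕ zeroV)
    vectors j = begin
      lincomb q zeroV (charVec G) j + (basis j₁ j + basis j₂ j)
        ≡⟨ cong (_+ charVec G K j) (lincomb-zeroV q (charVec G) j) ⟩
      charVec G K j
        ≡⟨ sym (+-identityʳ _) ⟩
      charVec G K j + 0
        ≡⟨ cong (_+ 0) (sym (lincomb-basis q K (charVec G) j)) ⟩
      lincomb q (basis K) (charVec G) j + 0
        ∎
    sizes : sumFin q zeroV + sumFin n (basis j₁ ⊕ basis j₂) ≡ sumFin q (basis K) + sumFin n zeroV + 1
    sizes = begin
      sumFin q zeroV + sumFin n (basis j₁ ⊕ basis j₂)
        ≡⟨ cong₂ _+_ (sumFin-zeroV q) (sumFin-⊕ n (basis j₁) (basis j₂)) ⟩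
      sumFin n (basis j₁) + sumFin n (basis j₂)
        ≡⟨ cong₂ _+_ (sumFin-basis n j₁) (sumFin-basis n j₂) ⟩
      2
        ≡⟨ sym (cong₂ (λ s t → s + t + 1) (sumFin-basis q K) (sumFin-zeroV n)) ⟩
      sumFin q (basis K) + sumFin n zeroV + 1
        ∎

  edge-vertex : ∀ {x y l} → charVec G K ≗V (basis x ⊕ basis y) → Incident G K x →
                l ≢ K → α l ≢ 0 → Incident G l x → β y ≢ 0 → ⊥
  edge-vertex {x} {y} {l} K≗xy K∋x l≢K αl≢0 l∋x βy≢0 with incident⇒otherEnd G l∋x
  ... | z , l≗xz , _ =
    no-improvement (decrement α l) (basis l) (decrement β y) (basis y) (basis K) (basis z) 0
      (decrement-⊕-basis α αl≢0) (decrement-⊕-basis β βy≢0)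
      vectors sizes (λ i → basis-offdiag (ι-avoids l≢K l∋x K∋x i ∘ sym)) (≤-reflexive (sym (basis-diag K)))
    where
    open ≡-Reasoning
    vectors : (lincomb q (basis l) (charVec G) ⊕ basis y) ≗V (lincomb q (basis K) (charVec G) ⊕ basis z)
    vectors j = begin
      lincomb q (basis l) (charVec G) j + basis y j
        ≡⟨ cong (_+ basis y j) (trans (lincomb-basis q l (charVec G) j) (l≗xz j)) ⟩
      basis x j + basis z j + basis y j
        ≡⟨ xy∙z≈xz∙y (basis x j) (basis z j) (basis y j) ⟩
      basis x j + basis y j + basis z j
        ≡⟨ cong (_+ basis z j) (sym (trans (lincomb-basis q K (charVec G) j) (K≗xy j))) ⟩
      lincomb q (basis K) (charVec G) j + basis z j
        ∎
    sizes : sumFin q (basis l) + sumFin n (basis y) ≡ sumFin q (basis K) + sumFin n (basis z) + 0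
    sizes = begin
      sumFin q (basis l) + sumFin n (basis y)
        ≡⟨ cong₂ _+_ (sumFin-basis q l) (sumFin-basis n y) ⟩
      2
        ≡⟨ sym (cong₂ (λ s t → s + t + 0) (sumFin-basis q K) (sumFin-basis n z)) ⟩
      sumFin q (basis K) + sumFin n (basis z) + 0
        ∎

  edge-edge : ∀ {l m} → l ≢ K → α l ≢ 0 → Incident G l j₁ → m ≢ K → α m ≢ 0 → Incident G m j₂ → ⊥
  edge-edge {l} {m} l≢K αl≢0 l∋j₁ m≢K αm≢0 m∋j₂
    with incident⇒otherEnd G l∋j₁ | incident⇒otherEnd G m∋j₂
  ... | z , l≗j₁z , j₁~z | z′ , m≗j₂z′ , j₂~z′ with adj⇒edge G (propertyP z z′ j₁~z j₂~z′)
  ... | p , p≗zz′ =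
    no-improvement (decrement (decrement α l) m) (basis l ⊕ basis m) β zeroV (basis K ⊕ basis p) zeroV 0
      (decrement₂-⊕-basis α αl≢0 αm≢0 l≢m) (λ i → sym (+-identityʳ (β i)))
      vectors sizes
      (λ i → cong₂ _+_ (basis-offdiag (ι-avoids l≢K l∋j₁ K∋j₁ i ∘ sym))
                       (basis-offdiag (ι-avoids m≢K m∋j₂ K∋j₂ i ∘ sym)))
      (≤-trans (≤-reflexive (sym (basis-diag K))) (m≤m+n _ _))
    where
    open ≡-Reasoning
    l≢m : l ≢ m
    l≢m l≡m = l≢K (incident-to-both-ends G l∋j₁ (subst (λ e → Incident G e j₂) (sym l≡m) m∋j₂))

    two-edges : ∀ r s → lincomb q (basis r ⊕ basis s) (charVec G) ≗V (charVec G r ⊕ charVec G s)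
    two-edges r s j = trans (lincomb-⊕ q (basis r) (basis s) (charVec G) j)
                            (cong₂ _+_ (lincomb-basis q r (charVec G) j) (lincomb-basis q s (charVec G) j))

    vectors : (lincomb q (basis l ⊕ basis m) (charVec G) ⊕ zeroV)
                ≗V (lincomb q (basis K ⊕ basis p) (charVec G) ⊕ zeroV)
    vectors j = cong (_+ 0) (begin
      lincomb q (basis l ⊕ basis m) (charVec G) j
        ≡⟨ two-edges l m j ⟩
      charVec G l j + charVec G m j
        ≡⟨ cong₂ _+_ (l≗j₁z j) (m≗j₂z′ j) ⟩
      (basis j₁ j + basis z j) + (basis j₂ j + basis z′ j)
        ≡⟨ interchange (basis j₁ j) (basis z j) (basis j₂ j) (basis z′ j) ⟩
      charVec G K j + (basis z j + basis z′ j)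
        ≡⟨ cong (charVec G K j +_) (sym (p≗zz′ j)) ⟩
      charVec G K j + charVec G p j
        ≡⟨ sym (two-edges K p j) ⟩
      lincomb q (basis K ⊕ basis p) (charVec G) j
        ∎)

    two-basisVectors : ∀ r s → sumFin q (basis r ⊕ basis s) ≡ 2
    two-basisVectors r s =
      trans (sumFin-⊕ q (basis r) (basis s)) (cong₂ _+_ (sumFin-basis q r) (sumFin-basis q s))

    sizes : sumFin q (basis l ⊕ basis m) + sumFin n zeroV
              ≡ sumFin q (basis K ⊕ basis p) + sumFin n zeroV + 0
    sizes = trans (cong (_+ sumFin n zeroV) (trans (two-basisVectors l m) (sym (two-basisVectors K p))))
                  (sym (+-identityʳ _))

  both-ends-covered : Cover j₁ → Cover j₂ → ⊥
  both-ends-covered (vertexCover βj₁≢0)          (vertexCover βj₂≢0)          = vertex-vertex βj₁≢0 βj₂≢0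
  both-ends-covered (edgeCover l l≢K αl≢0 l∋j₁) (vertexCover βj₂≢0)          =
    edge-vertex (λ _ → refl) K∋j₁ l≢K αl≢0 l∋j₁ βj₂≢0
  both-ends-covered (vertexCover βj₁≢0)          (edgeCover m m≢K αm≢0 m∋j₂) =
    edge-vertex (λ j → +-comm (basis j₁ j) (basis j₂ j)) K∋j₂ m≢K αm≢0 m∋j₂ βj₁≢0
  both-ends-covered (edgeCover l l≢K αl≢0 l∋j₁) (edgeCover m m≢K αm≢0 m∋j₂) =
    edge-edge l≢K αl≢0 l∋j₁ m≢K αm≢0 m∋j₂

  coefficient≡endWeight : α K ≡ w̃ j₁ ⊎ α K ≡ w̃ j₂
  coefficient≡endWeight with α K ℕ.≟ w̃ j₁ | α K ℕ.≟ w̃ j₂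
  ... | yes αK≡w̃j₁ | _            = inj₁ αK≡w̃j₁
  ... | no  _       | yes αK≡w̃j₂ = inj₂ αK≡w̃j₂
  ... | no  αK≢w̃j₁ | no αK≢w̃j₂  = ⊥-elim (both-ends-covered (cover K∋j₁ αK≢w̃j₁) (cover K∋j₂ αK≢w̃j₂))

proposition3p20 : (n q : ℕ) (G : SimpleGraph n q) → Connected G → q ≥ 1 →
    (u : ℕ) (u≤q : u ≤ q) →
    (∀ (i j : Fin u) → i ≢ j → DisjointEdges G (inject≤ i u≤q) (inject≤ j u≤q)) →
    (∀ (i : Fin u) → PropertyP G (inject≤ i u≤q)) →
    (w̃ : Vecℕ n) (a : ℕ) (α : Fin q → ℕ) (β : Fin n → ℕ) (λ′ : ℕ) →
    IsRep G (appendLast w̃ a) α β λ′ →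
    (∀ (α' : Fin q → ℕ) (β' : Fin n → ℕ) (λ'' : ℕ) → IsRep G (appendLast w̃ a) α' β' λ'' →
       sumFin u (λ i → α' (inject≤ i u≤q)) ≤ sumFin u (λ i → α (inject≤ i u≤q))) →
    ∀ (k : Fin u) →
      α (inject≤ k u≤q) ≡ w̃ · basis (SimpleGraph.end₁ G (inject≤ k u≤q))
      ⊎ α (inject≤ k u≤q) ≡ w̃ · basis (SimpleGraph.end₂ G (inject≤ k u≤q))
proposition3p20 n q G _ _ u u≤q disjoint propertyP w̃ a α β λ′ rep maximal k =
  map (λ αK≡w̃j₁ → trans αK≡w̃j₁ (sym (·-basis w̃ j₁)))
      (λ αK≡w̃j₂ → trans αK≡w̃j₂ (sym (·-basis w̃ j₂)))
      coefficient≡endWeight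
  where
  open MaximalRepresentation G u≤q disjoint w̃ a α β λ′ rep maximal k (propertyP k)
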